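{- Let $X$ be a finite set with $|X|\ge3$ and $\mathfrak{C}$ the set of partial choice functions on pairs from $X$. If $\mathscr{C}\subseteq\mathfrak{C}$ is symmetric, balanced and nontrivial, then for every 3-element set $\{x,y,z\}\subseteq X$ the triangular function $c^{x,y,z}$ belongs to $\operatorname{maj}^{\mathrm{cl}}(\mathscr{C})$. Moreover, there are finitely many $c_1,\dots,c_m\in\mathscr{C}$ (repetitions allowed) whose strict simple majority outcome is $c^{x,y,z}$, such that the number of $i$ with $c_i\{x,y\}=x$, the number with $c_i\{y,z\}=y$, and the number with $c_i\{z,x\}=z$ are all equal, and no $i$ has $c_i\{x,y\}=y$, $c_i\{y,z\}=z$ or $c_i\{z,x\}=x$.
   Context: $\mathfrak{C}$ is the set of all functions $c\colon Y\to X$ with $Y\subseteq\binom{X}{2}$ and $c\{x,y\}\in\{x,y\}$. $W^x_y(c)$ is $1$ if $c\{x,y\}=x$, $-1$ if $c\{x,y\}=y$, $0$ if $\{x,y\}\notin\operatorname{dom}c$ (including $x=y$). $\mathscr{C}$ is symmetric if closed under $c\mapsto c^\sigma$ for permutations $\sigma$ of $X$, where $c^\sigma\{\sigma(x),\sigma(y)\}=\sigma(x)$ iff $c\{x,y\}=x$. $c$ is balanced if $\sum_{y}W^x_y(c)=0$ for all $x$; $\mathscr{C}$ is balanced if all members are. $\mathscr{C}$ is trivial if $\mathscr{C}=\emptyset$ or $\mathscr{C}=\{c\}$ with $\operatorname{dom}c=\emptyset$. $\operatorname{maj}^{\mathrm{cl}}(\mathscr{C})$ is the set of $d\in\mathfrak{C}$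 for which there are rationals $r_c\in[0,1]$ with $\sum_c r_c=1$ and $d\{x,y\}=x\iff\sum_c W^x_y(c)r_c>0$. The strict simple majority outcome of $c_1,\dots,c_m$ is the $d\in\mathfrak{C}$ with $d\{u,v\}=u\iff\sum_{i}W^u_v(c_i)>0$. The triangular function $c^{x,y,z}$ has domain $\{\{x,y\},\{y,z\},\{z,x\}\}$ and $c^{x,y,z}\{x,y\}=x$, $c^{x,y,z}\{y,z\}=y$, $c^{x,y,z}\{z,x\}=z$. -}

module Defs where

open import Data.Nat using (ℕ)
open import Data.Bool using (Bool; true; false; if_then_else_; _∧_; _∨_)
open import Data.Bool.Properties using (∨-comm)
open import Data.Fin using (Fin; _≟_)
open import Data.Fin.Permutation using (Permutation′; _⟨$⟩ʳ_; _⟨$⟩ˡ_; inverseʳ)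
open import Data.Maybe using (Maybe; just; nothing)
import Data.Maybe as Maybe
open import Data.Maybe.Properties using (just-injective) renaming (≡-dec to ≡-decM)
open import Data.Integer using (ℤ; +_; -[1+_])
import Data.Integer as ℤ
open import Data.Rational using (ℚ; 0ℚ; 1ℚ; _/_)
import Data.Rational as ℚ
open import Data.List using (List; []; _∷_; length; filter)
open import Data.List.Relation.Unary.All using (All)
open import Data.Product using (Σ; ∃; ∃-syntax; _×_; _,_)
open import Data.Sum using (_⊎_; inj₁; inj₂)
open import Relation.Nullary using (¬_; yes; no; Dec)
open import Relation.Nullary.Decidable using (⌊_⌋)
open import Relation.Binary.PropositionalEquality
open import Function.Bundles using (_⇔_)
import Data.Empty

-- The ground set X is Fin n.
-- A (partial) choice function on pairs c : Y → X, Y ⊆ (X choose 2),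
-- c{x,y} ∈ {x,y}, is encoded by  pick x y  (= c{x,y} if {x,y} ∈ Y,
-- nothing otherwise), which is symmetric in x y, undefined on x = x,
-- and always returns one of its two arguments.

record Choice (n : ℕ) : Set where
  field
    pick   : Fin n → Fin n → Maybe (Fin n)
    pick-sym    : ∀ x y → pick x y ≡ pick y x
    pick-irrefl : ∀ x → pick x x ≡ nothing
    pick-valid  : ∀ x y w → pick x y ≡ just w → w ≡ x ⊎ w ≡ y
open Choice public

Family : ℕ → Set₁
Family n = Choice n → Set

W : ∀ {n} → Choice n → Fin n → Fin n → ℤ
W c x y with pick c x y
... | nothing = + 0
... | just w with w ≟ x
...   | yes _ = + 1
...   | no  _ = -[1+ 0 ]

sumFin : ∀ {n} → (Fin n → ℤ) → ℤ
sumFin {ℕ.zero}  f = + 0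
sumFin {ℕ.suc n} f = f Fin.zero ℤ.+ sumFin (λ i → f (Fin.suc i))
  where import Data.Fin as Fin

Balanced : ∀ {n} → Choice n → Set
Balanced c = ∀ x → sumFin (λ y → W c x y) ≡ + 0

BalancedFamily : ∀ {n} → Family n → Set
BalancedFamily 𝒞 = ∀ c → 𝒞 c → Balanced c

-- c^σ, with c^σ{σx,σy} = σ(c{x,y})
_^_ : ∀ {n} → Choice n → Permutation′ n → Choice n
pick (c ^ σ) u v = Maybe.map (σ ⟨$⟩ʳ_) (pick c (σ ⟨$⟩ˡ u) (σ ⟨$⟩ˡ v))
pick-sym (c ^ σ) u v = cong (Maybe.map (σ ⟨$⟩ʳ_)) (pick-sym c _ _)
pick-irrefl (c ^ σ) u rewrite pick-irrefl c (σ ⟨$⟩ˡ u) = refl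
pick-valid (c ^ σ) u v w eq with pick c (σ ⟨$⟩ˡ u) (σ ⟨$⟩ˡ v) in e
... | just w′ with just-injective eq | pick-valid c _ _ w′ e
...   | refl | inj₁ refl = inj₁ (inverseʳ σ)
...   | refl | inj₂ refl = inj₂ (inverseʳ σ)

Symmetric : ∀ {n} → Family n → Set
Symmetric 𝒞 = ∀ c (σ : Permutation′ _) → 𝒞 c → 𝒞 (c ^ σ)

EmptyDomain : ∀ {n} → Choice n → Set
EmptyDomain c = ∀ x y → pick c x y ≡ nothing

-- 𝒞 is nontrivial: it is neither ∅ nor {c} with dom c = ∅; i.e.
-- (classically equivalently) some member has nonempty domain.
NonTrivial : ∀ {n} → Family n → Set
NonTrivial 𝒞 = ∃[ c ] (𝒞 c × ¬ EmptyDomain c)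

-- maj^cl(𝒞): d ∈ maj^cl(𝒞) iff there are rationals r_c ∈ [0,1] (c ∈ 𝒞),
-- Σ r_c = 1, with d{x,y} = x ⟺ Σ_c W^x_y(c) r_c > 0.  The finitely many
-- members of 𝒞 carrying the weights are given as a list of pairs (c , r_c).

sumℚ : List ℚ → ℚ
sumℚ []       = 0ℚ
sumℚ (r ∷ rs) = r ℚ.+ sumℚ rs

weights : ∀ {n} → List (Choice n × ℚ) → List ℚ
weights []             = []
weights ((_ , r) ∷ cs) = r ∷ weights cs

weightedW : ∀ {n} → List (Choice n × ℚ) → Fin n → Fin n → ℚ
weightedW []             x y = 0ℚ
weightedW ((c , r) ∷ cs) x y = (W c x y / 1) ℚ.* r ℚ.+ weightedW cs x y

MajCl : ∀ {n} → Family n → Choice n → Set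
MajCl 𝒞 d = Σ (List (Choice _ × ℚ)) λ cs →
    All (λ { (c , r) → 𝒞 c × 0ℚ ℚ.≤ r × r ℚ.≤ 1ℚ }) cs
  × sumℚ (weights cs) ≡ 1ℚ
  × (∀ x y → (pick d x y ≡ just x) ⇔ (0ℚ ℚ.< weightedW cs x y))

sumW : ∀ {n} → List (Choice n) → Fin n → Fin n → ℤ
sumW []       x y = + 0
sumW (c ∷ cs) x y = W c x y ℤ.+ sumW cs x y

IsStrictMajorityOutcome : ∀ {n} → List (Choice n) → Choice n → Set
IsStrictMajorityOutcome cs d =
  ∀ u v → (pick d u v ≡ just u) ⇔ (+ 0 ℤ.< sumW cs u v)

wins : ∀ {n} → List (Choice n) → Fin n → Fin n → ℕ
wins cs x y = length (filter (λ c → ≡-decM _≟_ (pick c x y) (just x)) cs)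

edge : ∀ {n} → Fin n → Fin n → Fin n → Fin n → Bool
edge a b u v = (⌊ a ≟ u ⌋ ∧ ⌊ b ≟ v ⌋) ∨ (⌊ a ≟ v ⌋ ∧ ⌊ b ≟ u ⌋)

edge-sym : ∀ {n} (a b u v : Fin n) → edge a b u v ≡ edge a b v u
edge-sym a b u v = ∨-comm (⌊ a ≟ u ⌋ ∧ ⌊ b ≟ v ⌋) (⌊ a ≟ v ⌋ ∧ ⌊ b ≟ u ⌋)

edge-irrefl : ∀ {n} (a b u : Fin n) → ¬ a ≡ b → edge a b u u ≡ false
edge-irrefl a b u a≢b with a ≟ u | b ≟ u
... | yes refl | yes refl = Data.Empty.⊥-elim (a≢b refl)
  where import Data.Empty
... | yes _ | no _ = refl
... | no _  | _    = refl

f≢t : false ≡ true → Data.Empty.⊥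
f≢t ()

edge-valid : ∀ {n} (a b u v : Fin n) → edge a b u v ≡ true → a ≡ u ⊎ a ≡ v
edge-valid a b u v e with a ≟ u | a ≟ v
... | yes p | _     = inj₁ p
... | no _  | yes q = inj₂ q
... | no _  | no _  = Data.Empty.⊥-elim (f≢t e)

triPick : ∀ {n} → Fin n → Fin n → Fin n → Fin n → Fin n → Maybe (Fin n)
triPick x y z u v =
  if edge x y u v then just x else
  if edge y z u v then just y else
  if edge z x u v then just z else nothing

triangular : ∀ {n} (x y z : Fin n) → ¬ x ≡ y → ¬ y ≡ z → ¬ z ≡ x → Choice n
pick (triangular x y z _ _ _) = triPick x y z
pick-sym (triangular x y z _ _ _) u v
  rewrite edge-sym x y u v | edge-sym y z u v | edge-sym z x u v = refl
pick-irrefl (triangular x y z xy yz zx) u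
  rewrite edge-irrefl x y u xy | edge-irrefl y z u yz | edge-irrefl z x u zx = refl
pick-valid (triangular x y z _ _ _) u v w eq
  with edge x y u v in e1
... | true  with refl ← just-injective eq = edge-valid x y u v e1
... | false with edge y z u v in e2
...   | true  with refl ← just-injective eq = edge-valid y z u v e2
...   | false with edge z x u v in e3
...     | true  with refl ← just-injective eq = edge-valid z x u v e3
...     | false with () ← eq

module Submission where

-- The margin of a list of choice functions is the profile Σᵢ W(cᵢ).
--  * Seed.  A member c of 𝒞 with nonempty domain prefers some a to some b; comparing
--    the (zero) row sums of a and b yields t such that c never reverses a → b → t → a.
--    Relabelling c so that x,y,z go to (a,b,t), (b,t,a), (t,a,b) gives three members
--    whose profile F has F(x,y) = F(y,z) = F(z,x) > 0.
--  * Symmetrisation.  Adjoining the alternatives off the triangle one at a time turns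
--    F into a positive multiple G, still realised by such members, that is invariant
--    under swapping any two alternatives off the triangle.
--  * Analysis.  Antisymmetry, balancedness and this invariance force G to vanish on
--    every pair meeting the outside, so G is positive exactly on the three edges.

open import Defs
open import Data.Nat as ℕ using (ℕ; zero; suc)
open import Data.Fin using (Fin; zero; suc; punchIn; _≟_)
open import Data.Fin.Properties using (punchInᵢ≢i; any?; all?; ¬∀⟶∃¬)
import Data.Nat.Properties as ℕP
open import Data.Fin.Permutation using (Permutation′; _⟨$⟩ʳ_; _⟨$⟩ˡ_; inverseˡ; inverseʳ; transpose; flip; _∘ₚ_)
import Data.Fin.Permutation.Components as PC
open import Data.Maybe using (just; nothing)
open import Data.Maybe.Properties using (just-injective) renaming (≡-dec to ≡-decM)
import Data.Maybe as Maybe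
open import Data.Bool using (Bool; true; false; if_then_else_; not; _∧_; _∨_)
open import Data.Bool.Properties using (∧-conicalʳ; ¬-not)
open import Data.Integer as ℤ using (ℤ; +_; -[1+_]; +[1+_]; _+_; _*_; -_; _<_; _≤_)
import Data.Integer.Properties as ℤP
open import Data.Rational as ℚ using (ℚ; 0ℚ; 1ℚ; _/_)
import Data.Rational.Properties as ℚP
open import Data.Rational.Unnormalised as ℚᵘ using (mkℚᵘ; *≡*; *<*; *≤*)
import Data.Rational.Unnormalised.Properties as ℚᵘP
open import Data.List using (List; []; _∷_; _++_; map; allFin; length)
import Data.List.Membership.DecPropositional as DecMembership
open import Data.List.Membership.Propositional.Properties using (∈-allFin)
open import Data.List.Relation.Unary.All as All using (All; []; _∷_)
import Data.List.Relation.Unary.All.Properties as AllP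
open import Data.Product using (Σ; ∃-syntax; _×_; _,_; proj₁; proj₂)
open import Data.Sum using (_⊎_; inj₁; inj₂; [_,_]′)
open import Data.Empty using (⊥; ⊥-elim)
open import Relation.Nullary using (¬_; yes; no; Dec; does)
open import Relation.Nullary.Decidable using (dec-true; dec-false)
open import Relation.Nullary.Negation using (contradiction)
open import Relation.Binary.PropositionalEquality
open import Function using (_∘_; id; case_of_)
open import Function.Bundles using (_⇔_; mk⇔; Equivalence)
open import Function.Construct.Composition using (_⇔-∘_)
open import Data.Integer.Tactic.RingSolver using (solve-∀)
open import Algebra.Properties.CommutativeMonoid.Sum ℤP.+-0-commutativeMonoid
  using (sum; sum-cong-≗; sum-permute; sum-remove; ∑-distrib-+)

bool-clash : ∀ {β : Bool} → β ≡ false → β ≡ true → ⊥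
bool-clash refl ()

τ : ∀ {n} → Fin n → Fin n → Fin n → Fin n
τ = PC.transpose

τ-left : ∀ {n} (i j : Fin n) → τ i j i ≡ j
τ-left i j with i ≟ i
... | yes _  = refl
... | no i≢i = contradiction refl i≢i

τ-right : ∀ {n} (i j : Fin n) → τ i j j ≡ i
τ-right i j with j ≟ i
... | yes refl = refl
... | no _ with j ≟ j
...   | yes _  = refl
...   | no j≢j = contradiction refl j≢j

τ-other : ∀ {n} {i j k : Fin n} → ¬ k ≡ i → ¬ k ≡ j → τ i j k ≡ k
τ-other {i = i} {j} {k} k≢i k≢j with k ≟ i
... | yes k≡i = contradiction k≡i k≢i
... | no _ with k ≟ j
...   | yes k≡j = contradiction k≡j k≢j
...   | no _    = refl

τ-comm : ∀ {n} (i j k : Fin n) → τ i j k ≡ τ j i k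
τ-comm i j k = by-cases (k ≟ i) (k ≟ j)
  where
  by-cases : Dec (k ≡ i) → Dec (k ≡ j) → τ i j k ≡ τ j i k
  by-cases (yes refl) _          = trans (τ-left k j) (sym (τ-right j k))
  by-cases (no _)     (yes refl) = trans (τ-right i k) (sym (τ-left k i))
  by-cases (no k≢i)   (no k≢j)   = trans (τ-other k≢i k≢j) (sym (τ-other k≢j k≢i))

τ-involutive : ∀ {n} (i j k : Fin n) → τ i j (τ i j k) ≡ k
τ-involutive i j k = trans (cong (τ i j) (τ-comm i j k)) (PC.transpose-inverse i j)

τ-injective : ∀ {n} (i j : Fin n) {k l : Fin n} → τ i j k ≡ τ i j l → k ≡ l
τ-injective i j {k} {l} eq =
  trans (sym (τ-involutive i j k)) (trans (cong (τ i j) eq) (τ-involutive i j l))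

τ-self : ∀ {n} (i k : Fin n) → τ i i k ≡ k
τ-self i k = by-cases (k ≟ i)
  where
  by-cases : Dec (k ≡ i) → τ i i k ≡ k
  by-cases (yes refl) = τ-left k k
  by-cases (no k≢i)   = τ-other k≢i k≢i

τ-conj : ∀ {n} (s : Fin n → Fin n) → (∀ {a b} → s a ≡ s b → a ≡ b) →
         ∀ p q w → τ (s p) (s q) (s w) ≡ s (τ p q w)
τ-conj s s-inj p q w = by-cases (w ≟ p) (w ≟ q)
  where
  by-cases : Dec (w ≡ p) → Dec (w ≡ q) → τ (s p) (s q) (s w) ≡ s (τ p q w)
  by-cases (yes refl) _          = trans (τ-left (s w) (s q)) (cong s (sym (τ-left w q)))
  by-cases (no _)     (yes refl) = trans (τ-right (s p) (s w)) (cong s (sym (τ-right p w)))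
  by-cases (no w≢p)   (no w≢q)   =
    trans (τ-other (w≢p ∘ s-inj) (w≢q ∘ s-inj)) (cong s (sym (τ-other w≢p w≢q)))

τ-fixes : ∀ {n} (O : Fin n → Bool) {a b p} → O a ≡ true → O b ≡ true → O p ≡ false → τ a b p ≡ p
τ-fixes O Oa Ob Op = τ-other (λ { refl → bool-clash Op Oa }) (λ { refl → bool-clash Op Ob })

sumFin≡sum : ∀ {m} (f : Fin m → ℤ) → sumFin f ≡ sum f
sumFin≡sum {zero}  f = refl
sumFin≡sum {suc m} f = cong (λ r → f zero + r) (sumFin≡sum (f ∘ suc))

sumFin-cong : ∀ {m} {f g : Fin m → ℤ} → (∀ i → f i ≡ g i) → sumFin f ≡ sumFin g
sumFin-cong {f = f} {g} f≗g =
  trans (sumFin≡sum f) (trans (sum-cong-≗ f≗g) (sym (sumFin≡sum g)))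

sumFin-zero : ∀ {m} → sumFin {m} (λ _ → + 0) ≡ + 0
sumFin-zero {zero}  = refl
sumFin-zero {suc m} = trans (ℤP.+-identityˡ _) (sumFin-zero {m})

sumFin-+ : ∀ {m} (f g : Fin m → ℤ) → sumFin (λ i → f i + g i) ≡ sumFin f + sumFin g
sumFin-+ f g = begin
  sumFin (λ i → f i + g i)  ≡⟨ sumFin≡sum (λ i → f i + g i) ⟩
  sum (λ i → f i + g i)     ≡⟨ ∑-distrib-+ f g ⟩
  sum f + sum g             ≡⟨ sym (cong₂ _+_ (sumFin≡sum f) (sumFin≡sum g)) ⟩
  sumFin f + sumFin g       ∎
  where open ≡-Reasoning

sumFin-τ : ∀ {m} (f : Fin m → ℤ) (i j : Fin m) → sumFin f ≡ sumFin (f ∘ τ i j)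
sumFin-τ f i j = trans (sumFin≡sum f)
  (trans (sum-permute f (transpose i j)) (sym (sumFin≡sum (f ∘ τ i j))))

sumFin-agree-except : ∀ {m} (f g : Fin m → ℤ) (a : Fin m) → (∀ i → ¬ i ≡ a → f i ≡ g i) →
                      sumFin f + g a ≡ sumFin g + f a
sumFin-agree-except {suc m} f g a agree = begin
  sumFin f + g a                      ≡⟨ cong (_+ g a) (trans (sumFin≡sum f) (sum-remove f)) ⟩
  (f a + sum (f ∘ punchIn a)) + g a ≡⟨ cong (λ r → (f a + r) + g a) rest ⟩
  (f a + sum (g ∘ punchIn a)) + g a ≡⟨ swap-outer (f a) _ (g a) ⟩
  (g a + sum (g ∘ punchIn a)) + f a ≡⟨ cong (_+ f a) (sym (trans (sumFin≡sum g) (sum-remove g))) ⟩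
  sumFin g + f a                      ∎
  where
  open ≡-Reasoning
  rest : sum (f ∘ punchIn a) ≡ sum (g ∘ punchIn a)
  rest = sum-cong-≗ (λ j → agree (punchIn a j) (punchInᵢ≢i a j))
  swap-outer : ∀ (p r q : ℤ) → (p + r) + q ≡ (q + r) + p
  swap-outer = solve-∀

sumFin-mono : ∀ {m} (f g : Fin m → ℤ) → (∀ i → f i ≤ g i) → sumFin f ≤ sumFin g
sumFin-mono {zero}  f g f≤g = ℤP.≤-refl
sumFin-mono {suc m} f g f≤g =
  ℤP.+-mono-≤ (f≤g zero) (sumFin-mono (f ∘ suc) (g ∘ suc) (f≤g ∘ suc))

sumFin-strict : ∀ {m} (f g : Fin m → ℤ) → (∀ i → f i ≤ g i) → (a : Fin m) → f a < g a →
                sumFin f < sumFin g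
sumFin-strict {suc m} f g f≤g zero    lt =
  ℤP.+-mono-<-≤ lt (sumFin-mono (f ∘ suc) (g ∘ suc) (f≤g ∘ suc))
sumFin-strict {suc m} f g f≤g (suc a) lt =
  ℤP.+-mono-≤-< (f≤g zero) (sumFin-strict (f ∘ suc) (g ∘ suc) (f≤g ∘ suc) a lt)

size : ∀ {m} → (Fin m → Bool) → ℕ
size {zero}  D = 0
size {suc m} D = (if D zero then 1 else 0) ℕ.+ size (D ∘ suc)

sumFin-indicator : ∀ {m} (D : Fin m → Bool) (c : ℤ) →
                   sumFin (λ i → if D i then c else + 0) ≡ + size D * c
sumFin-indicator {zero}  D c = refl
sumFin-indicator {suc m} D c with D zero
... | true  = trans (cong (ℤ._+_ c) (sumFin-indicator (D ∘ suc) c)) (sym (ℤP.suc-* (+ size (D ∘ suc)) c))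
... | false = trans (ℤP.+-identityˡ _) (sumFin-indicator (D ∘ suc) c)

size-pos : ∀ {m} (D : Fin m → Bool) (v : Fin m) → D v ≡ true → 0 ℕ.< size D
size-pos D zero    Dv rewrite Dv = ℕ.s≤s ℕ.z≤n
size-pos D (suc v) Dv = ℕP.<-≤-trans (size-pos (D ∘ suc) v Dv) (ℕP.m≤n+m _ _)

exceeds-somewhere : ∀ {m} (f g : Fin m → ℤ) (a : Fin m) → sumFin f ≡ sumFin g → f a < g a →
                    ∃[ w ] g w < f w
exceeds-somewhere f g a eq fa<ga with any? (λ w → g w ℤ.<? f w)
... | yes found = found
... | no none   = contradiction eq (ℤP.<⇒≢ (sumFin-strict f g f≤g a fa<ga))
  where
  f≤g : ∀ w → f w ≤ g w
  f≤g w = ℤP.≮⇒≥ (λ gw<fw → none (w , gw<fw))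

data PickView {n} (c : Choice n) (u v : Fin n) : Set where
  prefers-left  : pick c u v ≡ just u → PickView c u v
  prefers-right : pick c u v ≡ just v → PickView c u v
  undefined     : pick c u v ≡ nothing → PickView c u v

pickView : ∀ {n} (c : Choice n) u v → PickView c u v
pickView c u v with pick c u v in eq
... | nothing = undefined eq
... | just w with pick-valid c u v w eq
...   | inj₁ refl = prefers-left eq
...   | inj₂ refl = prefers-right eq

W-win : ∀ {n} (c : Choice n) u v → pick c u v ≡ just u → W c u v ≡ + 1
W-win c u v eq with pick c u v
W-win c u v refl | just .u with u ≟ u
... | yes _   = refl
... | no u≢u  = contradiction refl u≢u

W-lose : ∀ {n} (c : Choice n) u v → pick c u v ≡ just v → W c u v ≡ -[1+ 0 ]
W-lose c u v eq with pick c u v in eq′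
W-lose c u v refl | just .v with v ≟ u
... | yes refl = contradiction (trans (sym eq′) (pick-irrefl c v)) λ ()
... | no _     = refl

W-none : ∀ {n} (c : Choice n) u v → pick c u v ≡ nothing → W c u v ≡ + 0
W-none c u v eq with pick c u v
W-none c u v refl | nothing = refl

W-diag : ∀ {n} (c : Choice n) u → W c u u ≡ + 0
W-diag c u = W-none c u u (pick-irrefl c u)

W-antisym : ∀ {n} (c : Choice n) u v → W c u v ≡ - W c v u
W-antisym c u v with pickView c u v
... | prefers-left  e = trans (W-win c u v e) (cong -_ (sym (W-lose c v u (trans (pick-sym c v u) e))))
... | prefers-right e = trans (W-lose c u v e) (cong -_ (sym (W-win c v u (trans (pick-sym c v u) e))))
... | undefined     e = trans (W-none c u v e) (cong -_ (sym (W-none c v u (trans (pick-sym c v u) e))))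

W-≤1 : ∀ {n} (c : Choice n) u v → W c u v ≤ + 1
W-≤1 c u v with pickView c u v
... | prefers-left  e rewrite W-win c u v e  = ℤP.≤-refl
... | prefers-right e rewrite W-lose c u v e = ℤ.-≤+
... | undefined     e rewrite W-none c u v e = ℤ.+≤+ ℕ.z≤n

W-≥-1 : ∀ {n} (c : Choice n) u v → -[1+ 0 ] ≤ W c u v
W-≥-1 c u v with pickView c u v
... | prefers-left  e rewrite W-win c u v e  = ℤ.-≤+
... | prefers-right e rewrite W-lose c u v e = ℤP.≤-refl
... | undefined     e rewrite W-none c u v e = ℤ.-≤+

W-nonneg : ∀ {n} (c : Choice n) u v → ¬ pick c u v ≡ just v → + 0 ≤ W c u v
W-nonneg c u v not-v with pickView c u v
... | prefers-left  e rewrite W-win c u v e  = ℤ.+≤+ ℕ.z≤n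
... | prefers-right e = contradiction e not-v
... | undefined     e rewrite W-none c u v e = ℤP.≤-refl

pick-^ : ∀ {n} (c : Choice n) (σ : Permutation′ n) u v w →
         pick c (σ ⟨$⟩ˡ u) (σ ⟨$⟩ˡ v) ≡ just (σ ⟨$⟩ˡ w) → pick (c ^ σ) u v ≡ just w
pick-^ c σ u v w eq = trans (cong (Maybe.map (σ ⟨$⟩ʳ_)) eq) (cong just (inverseʳ σ))

W-^ : ∀ {n} (c : Choice n) (σ : Permutation′ n) u v → W (c ^ σ) u v ≡ W c (σ ⟨$⟩ˡ u) (σ ⟨$⟩ˡ v)
W-^ c σ u v with pickView c (σ ⟨$⟩ˡ u) (σ ⟨$⟩ˡ v)
... | prefers-left  e = trans (W-win (c ^ σ) u v (pick-^ c σ u v u e)) (sym (W-win c _ _ e))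
... | prefers-right e = trans (W-lose (c ^ σ) u v (pick-^ c σ u v v e)) (sym (W-lose c _ _ e))
... | undefined     e = trans (W-none (c ^ σ) u v (cong (Maybe.map (σ ⟨$⟩ʳ_)) e)) (sym (W-none c _ _ e))

Profile : ℕ → Set
Profile n = Fin n → Fin n → ℤ

sumW-++ : ∀ {n} (cs ds : List (Choice n)) u v → sumW (cs ++ ds) u v ≡ sumW cs u v + sumW ds u v
sumW-++ []       ds u v = sym (ℤP.+-identityˡ _)
sumW-++ (c ∷ cs) ds u v =
  trans (cong (ℤ._+_ (W c u v)) (sumW-++ cs ds u v)) (sym (ℤP.+-assoc (W c u v) _ _))

sumW-^ : ∀ {n} (cs : List (Choice n)) (σ : Permutation′ n) u v →
         sumW (map (_^ σ) cs) u v ≡ sumW cs (σ ⟨$⟩ˡ u) (σ ⟨$⟩ˡ v)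
sumW-^ []       σ u v = refl
sumW-^ (c ∷ cs) σ u v = cong₂ _+_ (W-^ c σ u v) (sumW-^ cs σ u v)

sumW-antisym : ∀ {n} (cs : List (Choice n)) u v → sumW cs u v ≡ - sumW cs v u
sumW-antisym []       u v = refl
sumW-antisym (c ∷ cs) u v =
  trans (cong₂ _+_ (W-antisym c u v) (sumW-antisym cs u v)) (sym (ℤP.neg-distrib-+ (W c v u) _))

sumW-balanced : ∀ {n} (cs : List (Choice n)) → All Balanced cs → ∀ u → sumFin (sumW cs u) ≡ + 0
sumW-balanced {n} []       []         u = sumFin-zero {n}
sumW-balanced     (c ∷ cs) (bc ∷ bcs) u =
  trans (sumFin-+ (W c u) (sumW cs u)) (cong₂ _+_ (bc u) (sumW-balanced cs bcs u))

module Realisability {n} (A : Choice n → Set) where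

  Realisable : Profile n → Set
  Realisable F = Σ (List (Choice n)) λ cs → All A cs × (∀ u v → sumW cs u v ≡ F u v)

  realisable-zero : Realisable (λ _ _ → + 0)
  realisable-zero = [] , [] , λ _ _ → refl

  realisable-+ : ∀ {F G} → Realisable F → Realisable G → Realisable (λ u v → F u v + G u v)
  realisable-+ (cs , Acs , F≡) (ds , Ads , G≡) =
    cs ++ ds , AllP.++⁺ Acs Ads , λ u v → trans (sumW-++ cs ds u v) (cong₂ _+_ (F≡ u v) (G≡ u v))

  realisable-^ : ∀ {F} (σ : Permutation′ n) → (∀ c → A c → A (c ^ σ)) → Realisable F →
                 Realisable (λ u v → F (σ ⟨$⟩ˡ u) (σ ⟨$⟩ˡ v))
  realisable-^ σ A-^ (cs , Acs , F≡) =
    map (_^ σ) cs , AllP.map⁺ (All.map (λ {c} → A-^ c) Acs) , λ u v → trans (sumW-^ cs σ u v) (F≡ _ _)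

  realisable-antisym : ∀ {F} → Realisable F → ∀ u v → F u v ≡ - F v u
  realisable-antisym (cs , _ , F≡) u v =
    trans (sym (F≡ u v)) (trans (sumW-antisym cs u v) (cong -_ (F≡ v u)))

  realisable-balanced : ∀ {F} → (∀ c → A c → Balanced c) → Realisable F → ∀ u → sumFin (F u) ≡ + 0
  realisable-balanced A⇒bal (cs , Acs , F≡) u =
    trans (sumFin-cong (λ w → sym (F≡ u w))) (sumW-balanced cs (All.map (λ {c} → A⇒bal c) Acs) u)

SwapInvariant : ∀ {n} → (Fin n → Set) → Profile n → Set
SwapInvariant P F = ∀ a b → P a → P b → ∀ u v → F (τ a b u) (τ a b v) ≡ F u v

swapInvariant-mono : ∀ {n} {P Q : Fin n → Set} {F} → (∀ i → Q i → P i) →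
                     SwapInvariant P F → SwapInvariant Q F
swapInvariant-mono Q⊆P inv a b Qa Qb = inv a b (Q⊆P a Qa) (Q⊆P b Qb)

-- Every F ∈ 𝓡 has a positive multiple (on pairs outside O)
-- in 𝓡 that is invariant under all swaps inside O.  It is built by adjoining the
-- elements of O one at a time: if G is invariant under swaps inside D and J ∉ D, then
-- G + Σ_{i∈D} G∘(i J) is invariant under swaps inside D ∪ {J}.
module Symmetrisation {n} (O : Fin n → Bool) (𝓡 : Profile n → Set)
  (𝓡-zero : 𝓡 (λ _ _ → + 0))
  (𝓡-+ : ∀ {F G} → 𝓡 F → 𝓡 G → 𝓡 (λ u v → F u v + G u v))
  (𝓡-swap : ∀ {F} a b → O a ≡ true → O b ≡ true → 𝓡 F → 𝓡 (λ u v → F (τ a b u) (τ a b v)))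
  where

  open DecMembership (_≟_ {n}) using (_∈?_)

  𝓡-sum : ∀ {m} (H : Fin m → Profile n) → (∀ k → 𝓡 (H k)) → 𝓡 (λ u v → sumFin (λ k → H k u v))
  𝓡-sum {zero}  H H∈𝓡 = 𝓡-zero
  𝓡-sum {suc m} H H∈𝓡 = 𝓡-+ (H∈𝓡 zero) (𝓡-sum (H ∘ suc) (H∈𝓡 ∘ suc))

  image : (Fin n → Bool) → Fin n → Profile n → Fin n → Profile n
  image D J G i u v = if D i then G (τ i J u) (τ i J v) else + 0

  extend : (Fin n → Bool) → Fin n → Profile n → Profile n
  extend D J G u v = G u v + sumFin (λ i → image D J G i u v)

  extend-𝓡 : ∀ D J {G} → (∀ i → D i ≡ true → O i ≡ true) → O J ≡ true → 𝓡 G → 𝓡 (extend D J G)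
  extend-𝓡 D J {G} D⊆O OJ G∈𝓡 = 𝓡-+ G∈𝓡 (𝓡-sum (image D J G) image-𝓡)
    where
    image-𝓡 : ∀ i → 𝓡 (image D J G i)
    image-𝓡 i with D i in Di
    ... | true  = 𝓡-swap i J (D⊆O i Di) OJ G∈𝓡
    ... | false = 𝓡-zero

  -- On pairs outside O every image agrees with G, so extend only rescales G there.
  extend-scales : ∀ D J G → (∀ i → D i ≡ true → O i ≡ true) → O J ≡ true →
                  ∀ p q → O p ≡ false → O q ≡ false → extend D J G p q ≡ + suc (size D) * G p q
  extend-scales D J G D⊆O OJ p q Op Oq = begin
    G p q + sumFin (λ i → image D J G i p q)            ≡⟨ cong (ℤ._+_ (G p q)) (sumFin-cong fixed) ⟩
    G p q + sumFin (λ i → if D i then G p q else + 0)  ≡⟨ cong (ℤ._+_ (G p q)) (sumFin-indicator D (G p q)) ⟩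
    G p q + + size D * G p q                           ≡⟨ sym (ℤP.suc-* (+ size D) (G p q)) ⟩
    + suc (size D) * G p q                             ∎
    where
    open ≡-Reasoning
    fixed : ∀ i → image D J G i p q ≡ (if D i then G p q else + 0)
    fixed i with D i in Di
    ... | true  = cong₂ G (τ-fixes O (D⊆O i Di) OJ Op) (τ-fixes O (D⊆O i Di) OJ Oq)
    ... | false = refl

  module Adjoin (D : Fin n → Bool) (J : Fin n) (G : Profile n) (DJ : D J ≡ false)
                (inv : SwapInvariant (λ i → D i ≡ true) G) where

    J∉D : ∀ {a} → D a ≡ true → ¬ J ≡ a
    J∉D Da refl = bool-clash DJ Da

    D-τ : ∀ {a b} i → D a ≡ true → D b ≡ true → D (τ a b i) ≡ D i
    D-τ {a} {b} i Da Db = by-cases (i ≟ a) (i ≟ b)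
      where
      by-cases : Dec (i ≡ a) → Dec (i ≡ b) → D (τ a b i) ≡ D i
      by-cases (yes refl) _          = trans (cong D (τ-left i b)) (trans Db (sym Da))
      by-cases (no _)     (yes refl) = trans (cong D (τ-right a i)) (trans Da (sym Db))
      by-cases (no i≢a)   (no i≢b)   = cong D (τ-other i≢a i≢b)

    -- Swapping two members a, b of D permutes the images: image i ∘ (a b) = image ((a b) i).
    swap-inside : ∀ a b → D a ≡ true → D b ≡ true →
                  ∀ u v → extend D J G (τ a b u) (τ a b v) ≡ extend D J G u v
    swap-inside a b Da Db u v =
      cong₂ _+_ (inv a b Da Db u v)
        (trans (sumFin-cong permuted) (sym (sumFin-τ (λ i → image D J G i u v) a b)))
      where
      s : Fin n → Fin n
      s = τ a b
      relabel : ∀ i w → τ i J (s w) ≡ s (τ (s i) J w)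
      relabel i w =
        trans (cong₂ (λ p q → τ p q (s w)) (sym (τ-involutive a b i)) (sym (τ-other (J∉D Da) (J∉D Db))))
              (τ-conj s (τ-injective a b) (s i) J w)
      permuted : ∀ i → image D J G i (s u) (s v) ≡ image D J G (s i) u v
      permuted i rewrite D-τ i Da Db with D i in Di
      ... | true  = trans (cong₂ G (relabel i u) (relabel i v)) (inv a b Da Db _ _)
      ... | false = refl

    -- Swapping a member a of D with J exchanges G and its image under (a J), and
    -- permutes the other images: image i ∘ (a J) = image i ∘ (a i) for i ≠ a.
    swap-new : ∀ a → D a ≡ true → ∀ u v → extend D J G (τ a J u) (τ a J v) ≡ extend D J G u v
    swap-new a Da u v = begin
      G (τ a J u) (τ a J v) + sumFin new  ≡⟨ ℤP.+-comm _ (sumFin new) ⟩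
      sumFin new + G (τ a J u) (τ a J v)  ≡⟨ cong (ℤ._+_ (sumFin new)) (sym old-a) ⟩
      sumFin new + old a                  ≡⟨ sumFin-agree-except new old a agree ⟩
      sumFin old + new a                  ≡⟨ cong (ℤ._+_ (sumFin old)) new-a ⟩
      sumFin old + G u v                  ≡⟨ ℤP.+-comm (sumFin old) _ ⟩
      G u v + sumFin old                  ∎
      where
      open ≡-Reasoning
      new old : Fin n → ℤ
      new i = image D J G i (τ a J u) (τ a J v)
      old i = image D J G i u v
      relabel : ∀ i w → ¬ i ≡ a → τ i J (τ a J w) ≡ τ a i (τ i J w)
      relabel i w i≢a = sym (trans
        (cong₂ (λ p q → τ p q (τ i J w)) (sym (τ-other (i≢a ∘ sym) (J∉D Da ∘ sym))) (sym (τ-right i J)))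
        (τ-conj (τ i J) (τ-injective i J) a J w))
      agree : ∀ i → ¬ i ≡ a → new i ≡ old i
      agree i i≢a with D i in Di
      ... | true  = trans (cong₂ G (relabel i u i≢a) (relabel i v i≢a)) (inv a i Da Di _ _)
      ... | false = refl
      old-a : old a ≡ G (τ a J u) (τ a J v)
      old-a rewrite Da = refl
      new-a : new a ≡ G u v
      new-a rewrite Da = cong₂ G (τ-involutive a J u) (τ-involutive a J v)

    extend-invariant : SwapInvariant (λ i → D i ≡ true ⊎ i ≡ J) (extend D J G)
    extend-invariant a  b  (inj₁ Da)   (inj₁ Db)   = swap-inside a b Da Db
    extend-invariant a  .J (inj₁ Da)   (inj₂ refl) = swap-new a Da
    extend-invariant .J b  (inj₂ refl) (inj₁ Db)   u v =
      trans (cong₂ (extend D J G) (τ-comm J b u) (τ-comm J b v)) (swap-new b Db u v)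
    extend-invariant .J .J (inj₂ refl) (inj₂ refl) u v =
      cong₂ (extend D J G) (τ-self J u) (τ-self J v)

  record Symmetrised (F : Profile n) (D : Fin n → Bool) : Set where
    field
      profile    : Profile n
      in-𝓡       : 𝓡 profile
      invariant  : SwapInvariant (λ i → D i ≡ true) profile
      multiplier : ℕ
      scales     : ∀ p q → O p ≡ false → O q ≡ false → profile p q ≡ + suc multiplier * F p q

  restrict : ∀ {F D D′} → (∀ i → D′ i ≡ true → D i ≡ true) → Symmetrised F D → Symmetrised F D′
  restrict D′⊆D S = record
    { profile = profile ; in-𝓡 = in-𝓡 ; invariant = swapInvariant-mono D′⊆D invariant
    ; multiplier = multiplier ; scales = scales }
    where open Symmetrised S

  Processed : List (Fin n) → Fin n → Bool
  Processed js i = does (i ∈? js) ∧ O i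

  processed-⊆-O : ∀ js i → Processed js i ≡ true → O i ≡ true
  processed-⊆-O js i = ∧-conicalʳ (does (i ∈? js)) (O i)

  processed-∷ : ∀ J js i → Processed (J ∷ js) i ≡ true → Processed js i ≡ true ⊎ i ≡ J
  processed-∷ J js i e with i ≟ J
  ... | yes i≡J = inj₂ i≡J
  ... | no _    = inj₁ e

  processed-skip : ∀ J js → (O J ≡ true → Processed js J ≡ true) →
                   ∀ i → Processed (J ∷ js) i ≡ true → Processed js i ≡ true
  processed-skip J js already i e with processed-∷ J js i e
  ... | inj₁ e′   = e′
  ... | inj₂ refl = already (processed-⊆-O (J ∷ js) i e)

  -- Adjoining a new element J of O: extend G and multiply the multiplier by 1 + |D|.
  adjoin : ∀ {F} J js → O J ≡ true → Processed js J ≡ false →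
           Symmetrised F (Processed js) → Symmetrised F (Processed (J ∷ js))
  adjoin {F} J js OJ DJ S = record
    { profile    = extend D J G
    ; in-𝓡       = extend-𝓡 D J (processed-⊆-O js) OJ in-𝓡
    ; invariant  = swapInvariant-mono (processed-∷ J js) (Adjoin.extend-invariant D J G DJ invariant)
    ; multiplier = multiplier ℕ.+ size D ℕ.* suc multiplier
    ; scales     = λ p q Op Oq → begin
        extend D J G p q                          ≡⟨ extend-scales D J G (processed-⊆-O js) OJ p q Op Oq ⟩
        + suc (size D) * G p q                    ≡⟨ cong (ℤ._*_ (+ suc (size D))) (scales p q Op Oq) ⟩
        + suc (size D) * (+ suc multiplier * F p q) ≡⟨ sym (ℤP.*-assoc (+ suc (size D)) (+ suc multiplier) (F p q)) ⟩
        + suc (size D) * + suc multiplier * F p q ≡⟨ cong (ℤ._* F p q) (sym (ℤP.pos-* (suc (size D)) (suc multiplier))) ⟩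
        + (suc (size D) ℕ.* suc multiplier) * F p q ∎
    }
    where
    open Symmetrised S renaming (profile to G)
    open ≡-Reasoning
    D : Fin n → Bool
    D = Processed js

  symmetrise-list : ∀ {F} → 𝓡 F → ∀ js → Symmetrised F (Processed js)
  symmetrise-list {F} F∈𝓡 [] = record
    { profile = F ; in-𝓡 = F∈𝓡 ; invariant = λ _ _ () ; multiplier = 0
    ; scales = λ p q _ _ → sym (ℤP.*-identityˡ (F p q)) }
  symmetrise-list F∈𝓡 (J ∷ js) with O J in OJ | does (J ∈? js) in J∈js
  ... | true  | false = adjoin J js OJ (cong (_∧ O J) J∈js) (symmetrise-list F∈𝓡 js)
  ... | true  | true  = restrict (processed-skip J js (λ OJ′ → cong₂ _∧_ J∈js OJ′)) (symmetrise-list F∈𝓡 js)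
  ... | false | _     = restrict (processed-skip J js (⊥-elim ∘ bool-clash OJ))
                          (symmetrise-list F∈𝓡 js)

  symmetrise : ∀ {F} → 𝓡 F → Symmetrised F O
  symmetrise F∈𝓡 = restrict all-processed (symmetrise-list F∈𝓡 (allFin n))
    where
    all-processed : ∀ i → O i ≡ true → Processed (allFin n) i ≡ true
    all-processed i Oi = cong₂ _∧_ (dec-true (i ∈? allFin n) (∈-allFin i)) Oi

redirect : ∀ {n} (π : Permutation′ n) (z c : Fin n) →
           Σ (Permutation′ n) λ ρ → ρ ⟨$⟩ʳ z ≡ c ×
             (∀ w → ¬ w ≡ z → ¬ π ⟨$⟩ʳ w ≡ c → ρ ⟨$⟩ʳ w ≡ π ⟨$⟩ʳ w)
redirect π z c = π ∘ₚ transpose (π ⟨$⟩ʳ z) c , τ-left (π ⟨$⟩ʳ z) c ,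
  λ w w≢z πw≢c → τ-other (λ eq → w≢z (trans (sym (inverseˡ π)) (trans (cong (π ⟨$⟩ˡ_) eq) (inverseˡ π))))
                         πw≢c

map-triple : ∀ {n} {x y z a b c : Fin n} → ¬ x ≡ y → ¬ y ≡ z → ¬ z ≡ x →
             ¬ a ≡ b → ¬ b ≡ c → ¬ c ≡ a →
             Σ (Permutation′ n) λ σ → σ ⟨$⟩ˡ x ≡ a × σ ⟨$⟩ˡ y ≡ b × σ ⟨$⟩ˡ z ≡ c
map-triple {x = x} {y} {z} {a} {b} {c} x≢y y≢z z≢x a≢b b≢c c≢a
  with redirect (transpose x a) y b
... | ρ₂ , ρ₂y , ρ₂-keeps with redirect ρ₂ z c
...   | ρ₃ , ρ₃z , ρ₃-keeps =
  flip ρ₃ ,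
  trans (ρ₃-keeps x (z≢x ∘ sym) (λ eq → c≢a (trans (sym eq) ρ₂x))) ρ₂x ,
  trans (ρ₃-keeps y y≢z (λ eq → b≢c (trans (sym ρ₂y) eq))) ρ₂y ,
  ρ₃z
  where
  ρ₂x : ρ₂ ⟨$⟩ʳ x ≡ a
  ρ₂x = trans (ρ₂-keeps x x≢y (λ eq → a≢b (trans (sym (τ-left x a)) eq))) (τ-left x a)

Unreversing : ∀ {n} → Choice n → Fin n → Fin n → Fin n → Set
Unreversing c p q r = ¬ pick c p q ≡ just q × ¬ pick c q r ≡ just r × ¬ pick c r p ≡ just p

unreversing-rotate : ∀ {n} (c : Choice n) {p q r} → Unreversing c p q r → Unreversing c q r p
unreversing-rotate c (¬pq , ¬qr , ¬rp) = ¬qr , ¬rp , ¬pq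

pick-^⁻ : ∀ {n} (c : Choice n) (σ : Permutation′ n) u v w →
          pick (c ^ σ) u v ≡ just w → pick c (σ ⟨$⟩ˡ u) (σ ⟨$⟩ˡ v) ≡ just (σ ⟨$⟩ˡ w)
pick-^⁻ c σ u v w eq with pick c (σ ⟨$⟩ˡ u) (σ ⟨$⟩ˡ v)
pick-^⁻ c σ u v w refl | just w′ = cong just (sym (inverseˡ σ))

unreversing-^ : ∀ {n} (c : Choice n) (σ : Permutation′ n) x y z →
                Unreversing c (σ ⟨$⟩ˡ x) (σ ⟨$⟩ˡ y) (σ ⟨$⟩ˡ z) → Unreversing (c ^ σ) x y z
unreversing-^ c σ x y z (¬xy , ¬yz , ¬zx) =
  ¬xy ∘ pick-^⁻ c σ x y y , ¬yz ∘ pick-^⁻ c σ y z z , ¬zx ∘ pick-^⁻ c σ z x x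

wins-margin : ∀ {n} (cs : List (Choice n)) p q → All (λ c → ¬ pick c p q ≡ just q) cs →
              + wins cs p q ≡ sumW cs p q
wins-margin []       p q []          = refl
wins-margin (c ∷ cs) p q (¬q ∷ ¬qs) with ≡-decM _≟_ (pick c p q) (just p)
... | yes e  = cong₂ _+_ (sym (W-win c p q e)) (wins-margin cs p q ¬qs)
... | no ¬p with pickView c p q
...   | prefers-left  e = contradiction e ¬p
...   | prefers-right e = contradiction e ¬q
...   | undefined     e =
  trans (wins-margin cs p q ¬qs) (sym (trans (cong (_+ sumW cs p q) (W-none c p q e)) (ℤP.+-identityˡ _)))

preference-distinct : ∀ {n} (c : Choice n) {a b} → pick c a b ≡ just a → ¬ a ≡ b
preference-distinct c {a} a-over-b refl with () ← trans (sym a-over-b) (pick-irrefl c a)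

some-preference : ∀ {n} (c : Choice n) → ¬ EmptyDomain c → ∃[ a ] ∃[ b ] pick c a b ≡ just a
some-preference {n} c nonempty
  with ¬∀⟶∃¬ n (λ u → ∀ v → pick c u v ≡ nothing) (λ u → all? (λ v → ≡-decM _≟_ (pick c u v) nothing)) nonempty
... | u , ¬all with ¬∀⟶∃¬ n (λ v → pick c u v ≡ nothing) (λ v → ≡-decM _≟_ (pick c u v) nothing) ¬all
...   | v , defined with pickView c u v
...     | prefers-left  e = u , v , e
...     | prefers-right e = v , u , trans (pick-sym c v u) e
...     | undefined     e = contradiction e defined

-- If c prefers a to b, comparing the (zero) row sums of b and a exhibits an alternative t
-- with W(a,t) < W(b,t); then a → b → t → a is a cycle that c never reverses.
third-vertex : ∀ {n} (c : Choice n) → Balanced c → ∀ {a b} → pick c a b ≡ just a →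
               ∃[ t ] (¬ t ≡ a × ¬ t ≡ b × Unreversing c a b t)
third-vertex c balanced {a} {b} a-over-b =
  cycle-from (exceeds-somewhere (W c b) (W c a) b (trans (balanced b) (sym (balanced a))) b-below-a)
  where
  b-over-a : pick c b a ≡ just a
  b-over-a = trans (pick-sym c b a) a-over-b
  b-below-a : W c b b < W c a b
  b-below-a = subst₂ _<_ (sym (W-diag c b)) (sym (W-win c a b a-over-b)) (ℤ.+<+ (ℕ.s≤s ℕ.z≤n))
  cycle-from : ∃[ t ] W c a t < W c b t → ∃[ t ] (¬ t ≡ a × ¬ t ≡ b × Unreversing c a b t)
  cycle-from (t , at<bt) = t , t≢a , t≢b , ¬ab , ¬bt , ¬ta
    where
    ¬ab : ¬ pick c a b ≡ just b
    ¬ab = preference-distinct c a-over-b ∘ just-injective ∘ trans (sym a-over-b)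
    t≢a : ¬ t ≡ a
    t≢a refl with subst₂ _<_ (W-diag c t) (W-lose c b t b-over-a) at<bt
    ... | ()
    t≢b : ¬ t ≡ b
    t≢b refl with subst₂ _<_ (W-win c a t a-over-b) (W-diag c t) at<bt
    ... | ℤ.+<+ ()
    ¬bt : ¬ pick c b t ≡ just t
    ¬bt b-over-t = ℤP.<-irrefl refl
      (ℤP.≤-<-trans (W-≥-1 c a t) (subst (W c a t <_) (W-lose c b t b-over-t) at<bt))
    ¬ta : ¬ pick c t a ≡ just a
    ¬ta t-over-a = ℤP.<-irrefl refl
      (ℤP.<-≤-trans (subst (_< W c b t) (W-win c a t (trans (pick-sym c a t) t-over-a)) at<bt) (W-≤1 c b t))

self-negating : ∀ {a : ℤ} → a ≡ - a → a ≡ + 0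
self-negating {+ zero}    _  = refl
self-negating {+ suc _}   ()
self-negating { -[1+ _ ]} ()

sumFin-point : ∀ {m} (a : Fin m) (c : ℤ) → sumFin (λ w → if does (w ≟ a) then c else + 0) ≡ c
sumFin-point {m} a c = begin
  sumFin δ                      ≡⟨ sym (ℤP.+-identityʳ (sumFin δ)) ⟩
  sumFin δ + + 0                ≡⟨ sumFin-agree-except δ (λ _ → + 0) a off-a ⟩
  sumFin {m} (λ _ → + 0) + δ a  ≡⟨ cong₂ _+_ (sumFin-zero {m}) at-a ⟩
  + 0 + c                       ≡⟨ ℤP.+-identityˡ c ⟩
  c                             ∎
  where
  open ≡-Reasoning
  δ : Fin m → ℤ
  δ w = if does (w ≟ a) then c else + 0
  off-a : ∀ w → ¬ w ≡ a → δ w ≡ + 0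
  off-a w w≢a rewrite dec-false (w ≟ a) w≢a = refl
  at-a : δ a ≡ c
  at-a rewrite dec-true (a ≟ a) refl = refl

edge-true : ∀ {n} (a b u v : Fin n) → edge a b u v ≡ true → (a ≡ u × b ≡ v) ⊎ (a ≡ v × b ≡ u)
edge-true a b u v e with a ≟ u | b ≟ v | a ≟ v | b ≟ u
... | yes a≡u | yes b≡v | _       | _       = inj₁ (a≡u , b≡v)
... | _       | _       | yes a≡v | yes b≡u = inj₂ (a≡v , b≡u)
... | no _    | _       | no _    | _       = ⊥-elim (bool-clash refl e)
... | no _    | _       | yes _   | no _    = ⊥-elim (bool-clash refl e)
... | yes _   | no _    | no _    | _       = ⊥-elim (bool-clash refl e)
... | yes _   | no _    | yes _   | no _    = ⊥-elim (bool-clash refl e)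

edge-false : ∀ {n} (a b u v : Fin n) → ¬ ((a ≡ u × b ≡ v) ⊎ (a ≡ v × b ≡ u)) → edge a b u v ≡ false
edge-false a b u v not-edge = ¬-not (not-edge ∘ edge-true a b u v)

edge-here : ∀ {n} (a b : Fin n) → edge a b a b ≡ true
edge-here a b with a ≟ a | b ≟ b
... | yes _  | yes _  = refl
... | no a≢a | _      = contradiction refl a≢a
... | _      | no b≢b = contradiction refl b≢b

module Triangle {n} {x y z : Fin n} (x≢y : ¬ x ≡ y) (y≢z : ¬ y ≡ z) (z≢x : ¬ z ≡ x) where

  Forward : Fin n → Fin n → Set
  Forward u v = (u ≡ x × v ≡ y) ⊎ (u ≡ y × v ≡ z) ⊎ (u ≡ z × v ≡ x)

  isOutside : Fin n → Bool
  isOutside u = not (does (u ≟ x) ∨ does (u ≟ y) ∨ does (u ≟ z))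

  data Position (u : Fin n) : Set where
    at-x    : u ≡ x → Position u
    at-y    : u ≡ y → Position u
    at-z    : u ≡ z → Position u
    outside : isOutside u ≡ true → Position u

  position : ∀ u → Position u
  position u with u ≟ x | u ≟ y | u ≟ z
  ... | yes u≡x | _       | _       = at-x u≡x
  ... | no _    | yes u≡y | _       = at-y u≡y
  ... | no _    | no _    | yes u≡z = at-z u≡z
  ... | no u≢x  | no u≢y  | no u≢z  = outside outside-intro
    where
    outside-intro : isOutside u ≡ true
    outside-intro rewrite dec-false (u ≟ x) u≢x | dec-false (u ≟ y) u≢y | dec-false (u ≟ z) u≢z = refl

  x-inside : isOutside x ≡ false
  x-inside rewrite dec-true (x ≟ x) refl = refl

  y-inside : isOutside y ≡ false
  y-inside rewrite dec-false (y ≟ x) (x≢y ∘ sym) | dec-true (y ≟ y) refl = refl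

  z-inside : isOutside z ≡ false
  z-inside rewrite dec-false (z ≟ x) z≢x | dec-false (z ≟ y) (y≢z ∘ sym) | dec-true (z ≟ z) refl = refl

  outside-distinct : ∀ {u} → isOutside u ≡ true → ¬ u ≡ x × ¬ u ≡ y × ¬ u ≡ z
  outside-distinct out = (λ { refl → bool-clash x-inside out }) , (λ { refl → bool-clash y-inside out }) ,
                         (λ { refl → bool-clash z-inside out })

  sumFin-triangle : (f : Fin n → ℤ) → (∀ w → isOutside w ≡ true → f w ≡ + 0) →
                    sumFin f ≡ f x + (f y + f z)
  sumFin-triangle f vanishes = begin
    sumFin f                                 ≡⟨ sumFin-cong split ⟩
    sumFin (λ w → δ x w + (δ y w + δ z w))   ≡⟨ sumFin-+ (δ x) _ ⟩
    sumFin (δ x) + sumFin (λ w → δ y w + δ z w)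
      ≡⟨ cong (ℤ._+_ (sumFin (δ x))) (sumFin-+ (δ y) (δ z)) ⟩
    sumFin (δ x) + (sumFin (δ y) + sumFin (δ z))
      ≡⟨ cong₂ _+_ (sumFin-point x (f x)) (cong₂ _+_ (sumFin-point y (f y)) (sumFin-point z (f z))) ⟩
    f x + (f y + f z)                        ∎
    where
    open ≡-Reasoning
    δ : Fin n → Fin n → ℤ
    δ a w = if does (w ≟ a) then f a else + 0
    split : ∀ w → f w ≡ δ x w + (δ y w + δ z w)
    split w with position w
    ... | at-x refl rewrite dec-true (x ≟ x) refl | dec-false (x ≟ y) x≢y | dec-false (x ≟ z) (z≢x ∘ sym) =
      sym (ℤP.+-identityʳ (f x))
    ... | at-y refl rewrite dec-false (y ≟ x) (x≢y ∘ sym) | dec-true (y ≟ y) refl | dec-false (y ≟ z) y≢z =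
      sym (trans (ℤP.+-identityˡ _) (ℤP.+-identityʳ (f y)))
    ... | at-z refl rewrite dec-false (z ≟ x) z≢x | dec-false (z ≟ y) (y≢z ∘ sym) | dec-true (z ≟ z) refl =
      sym (trans (ℤP.+-identityˡ _) (ℤP.+-identityˡ (f z)))
    ... | outside out with outside-distinct out | vanishes w out
    ...   | w≢x , w≢y , w≢z | fw≡0
      rewrite dec-false (w ≟ x) w≢x | dec-false (w ≟ y) w≢y | dec-false (w ≟ z) w≢z = fw≡0

  triangle : Choice n
  triangle = triangular x y z x≢y y≢z z≢x

  xy≢yz : ¬ ((x ≡ y × y ≡ z) ⊎ (x ≡ z × y ≡ y))
  xy≢yz (inj₁ (x≡y , _)) = x≢y x≡y
  xy≢yz (inj₂ (x≡z , _)) = z≢x (sym x≡z)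

  xy≢zx : ¬ ((x ≡ z × y ≡ x) ⊎ (x ≡ x × y ≡ z))
  xy≢zx (inj₁ (x≡z , _)) = z≢x (sym x≡z)
  xy≢zx (inj₂ (_ , y≡z)) = y≢z y≡z

  yz≢zx : ¬ ((y ≡ z × z ≡ x) ⊎ (y ≡ x × z ≡ z))
  yz≢zx (inj₁ (y≡z , _)) = y≢z y≡z
  yz≢zx (inj₂ (y≡x , _)) = x≢y (sym y≡x)

  triangle-forward : ∀ u v → Forward u v → pick triangle u v ≡ just u
  triangle-forward u v (inj₁ (u≡x , v≡y)) rewrite u≡x | v≡y | edge-here x y = refl
  triangle-forward u v (inj₂ (inj₁ (u≡y , v≡z)))
    rewrite u≡y | v≡z | edge-false x y y z xy≢yz | edge-here y z = refl
  triangle-forward u v (inj₂ (inj₂ (u≡z , v≡x)))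
    rewrite u≡z | v≡x | edge-false x y z x xy≢zx | edge-false y z z x yz≢zx | edge-here z x = refl

  oriented : ∀ {a b u v : Fin n} → ¬ a ≡ b → (a ≡ u × b ≡ v) ⊎ (a ≡ v × b ≡ u) → a ≡ u → u ≡ a × v ≡ b
  oriented a≢b (inj₁ (a≡u , b≡v)) _   = sym a≡u , sym b≡v
  oriented a≢b (inj₂ (a≡v , b≡u)) a≡u = ⊥-elim (a≢b (trans a≡u (sym b≡u)))

  triangle-picks : ∀ u v → pick triangle u v ≡ just u → Forward u v
  triangle-picks u v eq with edge x y u v in e₁
  ... | true  = inj₁ (oriented x≢y (edge-true x y u v e₁) (just-injective eq))
  ... | false with edge y z u v in e₂
  ...   | true  = inj₂ (inj₁ (oriented y≢z (edge-true y z u v e₂) (just-injective eq)))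
  ...   | false with edge z x u v in e₃
  ...     | true  = inj₂ (inj₂ (oriented z≢x (edge-true z x u v e₃) (just-injective eq)))
  ...     | false with () ← eq

  record Cyclic (G : Profile n) (s : ℤ) : Set where
    field
      antisym   : ∀ u v → G u v ≡ - G v u
      balanced  : ∀ u → sumFin (G u) ≡ + 0
      invariant : SwapInvariant (λ i → isOutside i ≡ true) G
      at-xy     : G x y ≡ s
      at-yz     : G y z ≡ s
      at-zx     : G z x ≡ s

  module CyclicProperties {G : Profile n} {s : ℤ} (cyclic : Cyclic G s) where
    open Cyclic cyclic

    diagonal : ∀ u → G u u ≡ + 0
    diagonal u = self-negating (antisym u u)

    at-yx : G y x ≡ - s
    at-yx = trans (antisym y x) (cong -_ at-xy)

    at-zy : G z y ≡ - s
    at-zy = trans (antisym z y) (cong -_ at-yz)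

    at-xz : G x z ≡ - s
    at-xz = trans (antisym x z) (cong -_ at-zx)

    -- Swapping u and v shows G u v = G v u = - G u v.
    outside-outside : ∀ u v → isOutside u ≡ true → isOutside v ≡ true → G u v ≡ + 0
    outside-outside u v out-u out-v = self-negating (begin
      G u v                    ≡⟨ sym (invariant u v out-u out-v u v) ⟩
      G (τ u v u) (τ u v v)    ≡⟨ cong₂ G (τ-left u v) (τ-right u v) ⟩
      G v u                    ≡⟨ antisym v u ⟩
      - G u v                  ∎)
      where open ≡-Reasoning

    triangle-row : ∀ {t} → isOutside t ≡ false → G t x + (G t y + G t z) ≡ + 0
    triangle-row {t} in-t with position t
    ... | at-x refl rewrite diagonal x | at-xy | at-xz = trans (ℤP.+-identityˡ _) (ℤP.+-inverseʳ s)
    ... | at-y refl rewrite at-yx | diagonal y | at-yz =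
      trans (cong (ℤ._+_ (- s)) (ℤP.+-identityˡ s)) (ℤP.+-inverseˡ s)
    ... | at-z refl rewrite at-zx | at-zy | diagonal z =
      trans (cong (ℤ._+_ s) (ℤP.+-identityʳ (- s))) (ℤP.+-inverseʳ s)
    ... | outside out = ⊥-elim (bool-clash in-t out)

    -- A row from the triangle is constant on the outside (by invariance), and that
    -- constant times the number of outside alternatives is the row sum, i.e. zero.
    inside-outside : ∀ t v → isOutside t ≡ false → isOutside v ≡ true → G t v ≡ + 0
    inside-outside t v in-t out-v =
      [ (λ size≡0 → contradiction (ℤP.+-injective size≡0) size≢0) , id ]′ (ℤP.i*j≡0⇒i≡0∨j≡0 (+ size isOutside) scaled)
      where
      c : ℤ
      c = G t v
      outer inner : Fin n → ℤ
      outer w = if isOutside w then c else + 0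
      inner w = if isOutside w then + 0 else G t w
      constant : ∀ w → isOutside w ≡ true → G t w ≡ c
      constant w out-w = begin
        G t w                    ≡⟨ cong₂ G (sym (τ-fixes isOutside out-v out-w in-t)) (sym (τ-left v w)) ⟩
        G (τ v w t) (τ v w v)    ≡⟨ invariant v w out-v out-w t v ⟩
        G t v                    ∎
        where open ≡-Reasoning
      split : ∀ w → G t w ≡ outer w + inner w
      split w with isOutside w in out-w
      ... | true  = trans (constant w out-w) (sym (ℤP.+-identityʳ c))
      ... | false = sym (ℤP.+-identityˡ (G t w))
      inner-by-position : ∀ {w β} → isOutside w ≡ β → inner w ≡ (if β then + 0 else G t w)
      inner-by-position = cong (λ β → if β then + 0 else _)
      inner-sum : sumFin inner ≡ + 0
      inner-sum = begin
        sumFin inner                   ≡⟨ sumFin-triangle inner (λ _ → inner-by-position) ⟩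
        inner x + (inner y + inner z)  ≡⟨ cong₂ _+_ (inner-by-position x-inside)
                                            (cong₂ _+_ (inner-by-position y-inside) (inner-by-position z-inside)) ⟩
        G t x + (G t y + G t z)        ≡⟨ triangle-row in-t ⟩
        + 0                            ∎
        where open ≡-Reasoning
      scaled : + size isOutside * c ≡ + 0
      scaled = begin
        + size isOutside * c                ≡⟨ sym (sumFin-indicator isOutside c) ⟩
        sumFin outer                        ≡⟨ sym (ℤP.+-identityʳ (sumFin outer)) ⟩
        sumFin outer + + 0                  ≡⟨ cong (ℤ._+_ (sumFin outer)) (sym inner-sum) ⟩
        sumFin outer + sumFin inner         ≡⟨ sym (sumFin-+ outer inner) ⟩
        sumFin (λ w → outer w + inner w)    ≡⟨ sumFin-cong (λ w → sym (split w)) ⟩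
        sumFin (G t)                        ≡⟨ balanced t ⟩
        + 0                                 ∎
        where open ≡-Reasoning
      size≢0 : ¬ size isOutside ≡ 0
      size≢0 eq = ℕP.<-irrefl (sym eq) (size-pos isOutside v out-v)

    outside-inside : ∀ u t → isOutside u ≡ true → isOutside t ≡ false → G u t ≡ + 0
    outside-inside u t out-u in-t = trans (antisym u t) (cong -_ (inside-outside t u in-t out-u))

    module _ (s-pos : + 0 < s) where

      not-positive : ∀ {u v} → G u v ≡ + 0 ⊎ G u v ≡ - s → ¬ + 0 < G u v
      not-positive (inj₁ vanishes) pos = ℤP.<-irrefl refl (subst (+ 0 <_) vanishes pos)
      not-positive (inj₂ negative) pos =
        ℤP.<-asym s-pos (subst (_< + 0) (ℤP.neg-involutive s) (ℤP.neg-mono-< (subst (+ 0 <_) negative pos)))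

      forward⇒positive : ∀ u v → Forward u v → + 0 < G u v
      forward⇒positive u v (inj₁ (refl , refl))        = subst (+ 0 <_) (sym at-xy) s-pos
      forward⇒positive u v (inj₂ (inj₁ (refl , refl))) = subst (+ 0 <_) (sym at-yz) s-pos
      forward⇒positive u v (inj₂ (inj₂ (refl , refl))) = subst (+ 0 <_) (sym at-zx) s-pos

      positive⇒forward : ∀ u v → + 0 < G u v → Forward u v
      positive⇒forward u v pos with position u | position v
      ... | outside ou | outside ov = ⊥-elim (not-positive (inj₁ (outside-outside u v ou ov)) pos)
      ... | outside ou | at-x refl  = ⊥-elim (not-positive (inj₁ (outside-inside u x ou x-inside)) pos)
      ... | outside ou | at-y refl  = ⊥-elim (not-positive (inj₁ (outside-inside u y ou y-inside)) pos)
      ... | outside ou | at-z refl  = ⊥-elim (not-positive (inj₁ (outside-inside u z ou z-inside)) pos)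
      ... | at-x refl  | outside ov = ⊥-elim (not-positive (inj₁ (inside-outside x v x-inside ov)) pos)
      ... | at-y refl  | outside ov = ⊥-elim (not-positive (inj₁ (inside-outside y v y-inside ov)) pos)
      ... | at-z refl  | outside ov = ⊥-elim (not-positive (inj₁ (inside-outside z v z-inside ov)) pos)
      ... | at-x refl  | at-y refl  = inj₁ (refl , refl)
      ... | at-y refl  | at-z refl  = inj₂ (inj₁ (refl , refl))
      ... | at-z refl  | at-x refl  = inj₂ (inj₂ (refl , refl))
      ... | at-x refl  | at-x refl  = ⊥-elim (not-positive (inj₁ (diagonal x)) pos)
      ... | at-y refl  | at-y refl  = ⊥-elim (not-positive (inj₁ (diagonal y)) pos)
      ... | at-z refl  | at-z refl  = ⊥-elim (not-positive (inj₁ (diagonal z)) pos)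
      ... | at-y refl  | at-x refl  = ⊥-elim (not-positive (inj₂ at-yx) pos)
      ... | at-z refl  | at-y refl  = ⊥-elim (not-positive (inj₂ at-zy) pos)
      ... | at-x refl  | at-z refl  = ⊥-elim (not-positive (inj₂ at-xz) pos)


  triangle-needs-voters : ¬ IsStrictMajorityOutcome [] triangle
  triangle-needs-voters outcome =
    ℤP.<-irrefl refl (Equivalence.to (outcome x y) (triangle-forward x y (inj₁ (refl , refl))))

  unreversing-fixed : ∀ c (σ : Permutation′ n) → σ ⟨$⟩ˡ x ≡ x → σ ⟨$⟩ˡ y ≡ y → σ ⟨$⟩ˡ z ≡ z →
                      Unreversing c x y z → Unreversing (c ^ σ) x y z
  unreversing-fixed c σ σx σy σz unrev = unreversing-^ c σ x y z
    (subst₂ (λ p q → Unreversing c p q (σ ⟨$⟩ˡ z)) (sym σx) (sym σy) (subst (Unreversing c x y) (sym σz) unrev))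

  positive-multiple : ∀ m {s} → + 0 < s → + 0 < + suc m * s
  positive-multiple m {+[1+ _ ]} _           = ℤ.+<+ (ℕ.s≤s ℕ.z≤n)
  positive-multiple m {+ zero}   (ℤ.+<+ ())

  module Construction (𝒞 : Family n) (symmetric : Symmetric 𝒞) (balanced : BalancedFamily 𝒞) where

    Admissible : Choice n → Set
    Admissible c = 𝒞 c × Unreversing c x y z

    open Realisability Admissible

    transplant : ∀ {c p q r} → ¬ p ≡ q → ¬ q ≡ r → ¬ r ≡ p → 𝒞 c → Unreversing c p q r →
                 ∃[ c′ ] (Admissible c′ × W c′ x y ≡ W c p q × W c′ y z ≡ W c q r × W c′ z x ≡ W c r p)
    transplant {c} p≢q q≢r r≢p c∈𝒞 unrev with map-triple x≢y y≢z z≢x p≢q q≢r r≢p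
    ... | σ , refl , refl , refl =
      c ^ σ , (symmetric c σ c∈𝒞 , unreversing-^ c σ x y z unrev) , W-^ c σ x y , W-^ c σ y z , W-^ c σ z x

    -- Swapping two outside alternatives fixes the triangle, so preserves admissibility.
    realisable-swap : ∀ {F} a b → isOutside a ≡ true → isOutside b ≡ true → Realisable F →
                      Realisable (λ u v → F (τ a b u) (τ a b v))
    realisable-swap a b out-a out-b = realisable-^ (transpose b a) admissible-swap
      where
      fixes : ∀ {p} → isOutside p ≡ false → τ a b p ≡ p
      fixes = τ-fixes isOutside out-a out-b
      admissible-swap : ∀ c → Admissible c → Admissible (c ^ transpose b a)
      admissible-swap c (c∈𝒞 , unrev) =
        symmetric c (transpose b a) c∈𝒞 ,
        unreversing-fixed c (transpose b a) (fixes x-inside) (fixes y-inside) (fixes z-inside) unrev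

    record Seed : Set where
      field
        profile    : Profile n
        margin     : ℤ
        realisable : Realisable profile
        at-xy      : profile x y ≡ margin
        at-yz      : profile y z ≡ margin
        at-zx      : profile z x ≡ margin
        positive   : + 0 < margin

    -- A member c preferring a to b closes an unreversed cycle a → b → t → a; the three
    -- relabellings of c carrying x → y → z onto its rotations add up to equal margins
    -- W(a,b) + W(b,t) + W(t,a) > 0 on the three triangle edges.
    seed : NonTrivial 𝒞 → Seed
    seed (c , c∈𝒞 , nonempty) with some-preference c nonempty
    ... | a , b , a-over-b with third-vertex c (balanced c c∈𝒞) a-over-b | preference-distinct c a-over-b
    ... | t , t≢a , t≢b , unrev | a≢b
      with transplant a≢b (t≢b ∘ sym) t≢a c∈𝒞 unrev
         | transplant (t≢b ∘ sym) t≢a a≢b c∈𝒞 (unreversing-rotate c unrev)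
         | transplant t≢a a≢b (t≢b ∘ sym) c∈𝒞 (unreversing-rotate c (unreversing-rotate c unrev))
    ... | c₁ , adm₁ , ab₁ , bt₁ , ta₁ | c₂ , adm₂ , bt₂ , ta₂ , ab₂ | c₃ , adm₃ , ta₃ , ab₃ , bt₃ = record
      { profile    = sumW voters
      ; margin     = A + (B + (C + + 0))
      ; realisable = voters , adm₁ ∷ adm₂ ∷ adm₃ ∷ [] , (λ _ _ → refl)
      ; at-xy      = cong₂ _+_ ab₁ (cong₂ _+_ bt₂ (cong₂ _+_ ta₃ refl))
      ; at-yz      = trans (cong₂ _+_ bt₁ (cong₂ _+_ ta₂ (cong₂ _+_ ab₃ refl))) (rotate A B C)
      ; at-zx      = trans (cong₂ _+_ ta₁ (cong₂ _+_ ab₂ (cong₂ _+_ bt₃ refl)))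
                           (trans (rotate B C A) (rotate A B C))
      ; positive   = ℤP.+-mono-<-≤ (subst (+ 0 <_) (sym (W-win c a b a-over-b)) (ℤ.+<+ (ℕ.s≤s ℕ.z≤n)))
                       (ℤP.+-mono-≤ (W-nonneg c b t (proj₁ (proj₂ unrev)))
                         (ℤP.+-mono-≤ (W-nonneg c t a (proj₂ (proj₂ unrev))) ℤP.≤-refl))
      }
      where
      voters : List (Choice n)
      voters = c₁ ∷ c₂ ∷ c₃ ∷ []
      A B C : ℤ
      A = W c a b
      B = W c b t
      C = W c t a
      rotate : ∀ (A B C : ℤ) → B + (C + (A + + 0)) ≡ A + (B + (C + + 0))
      rotate = solve-∀

    open Symmetrisation isOutside Realisable realisable-zero realisable-+ realisable-swap

    record Witness : Set where
      field
        voters     : List (Choice n)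
        admissible : All Admissible voters
        nonempty   : ¬ voters ≡ []
        outcome    : IsStrictMajorityOutcome voters triangle
        wins-xy-yz : wins voters x y ≡ wins voters y z
        wins-yz-zx : wins voters y z ≡ wins voters z x

    -- The symmetrisation of a seed, being cyclic with positive margin, is positive exactly
    -- on the triangle edges; its voters are the witness.
    witness-from : (S : Seed) → Symmetrised (Seed.profile S) isOutside → Witness
    witness-from S sym-S = record
      { voters     = voters
      ; admissible = admissible
      ; nonempty   = λ empty →
          triangle-needs-voters (subst (λ cs → IsStrictMajorityOutcome cs triangle) empty outcome)
      ; outcome    = outcome
      ; wins-xy-yz = ℤP.+-injective (trans wins-xy (sym wins-yz))
      ; wins-yz-zx = ℤP.+-injective (trans wins-yz (sym wins-zx))
      }
      where
      open Seed S using (margin; positive) renaming (at-xy to F-xy; at-yz to F-yz; at-zx to F-zx)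
      open Symmetrised sym-S using (profile; in-𝓡; invariant; multiplier; scales)
      G : Profile n
      G = profile
      s : ℤ
      s = + suc multiplier * margin
      s-pos : + 0 < s
      s-pos = positive-multiple multiplier positive
      cyclic : Cyclic G s
      cyclic = record
        { antisym   = realisable-antisym in-𝓡
        ; balanced  = realisable-balanced (λ c → balanced c ∘ proj₁) in-𝓡
        ; invariant = invariant
        ; at-xy     = trans (scales x y x-inside y-inside) (cong (ℤ._*_ (+ suc multiplier)) F-xy)
        ; at-yz     = trans (scales y z y-inside z-inside) (cong (ℤ._*_ (+ suc multiplier)) F-yz)
        ; at-zx     = trans (scales z x z-inside x-inside) (cong (ℤ._*_ (+ suc multiplier)) F-zx)
        }
      open Cyclic cyclic using (at-xy; at-yz; at-zx)
      open CyclicProperties cyclic using (forward⇒positive; positive⇒forward)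
      voters : List (Choice n)
      voters = proj₁ in-𝓡
      admissible : All Admissible voters
      admissible = proj₁ (proj₂ in-𝓡)
      margins : ∀ u v → sumW voters u v ≡ G u v
      margins = proj₂ (proj₂ in-𝓡)
      outcome : IsStrictMajorityOutcome voters triangle
      outcome u v = mk⇔
        (λ picks → subst (+ 0 <_) (sym (margins u v)) (forward⇒positive s-pos u v (triangle-picks u v picks)))
        (λ pos → triangle-forward u v (positive⇒forward s-pos u v (subst (+ 0 <_) (margins u v) pos)))
      wins-at : ∀ p q → (∀ c → Unreversing c x y z → ¬ pick c p q ≡ just q) → + wins voters p q ≡ G p q
      wins-at p q unreversed =
        trans (wins-margin voters p q (All.map (λ {c} → unreversed c ∘ proj₂) admissible)) (margins p q)
      wins-xy : + wins voters x y ≡ s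
      wins-xy = trans (wins-at x y (λ _ → proj₁)) at-xy
      wins-yz : + wins voters y z ≡ s
      wins-yz = trans (wins-at y z (λ _ → proj₁ ∘ proj₂)) at-yz
      wins-zx : + wins voters z x ≡ s
      wins-zx = trans (wins-at z x (λ _ → proj₂ ∘ proj₂)) at-zx

    witness : NonTrivial 𝒞 → Witness
    witness nontrivial = witness-from S (symmetrise (Seed.realisable S))
      where
      S : Seed
      S = seed nontrivial

ι : ℤ → ℚ
ι a = a / 1

ι-unnormalised : ∀ a → ℚ.toℚᵘ (ι a) ℚᵘ.≃ mkℚᵘ a 0
ι-unnormalised a = ℚP.toℚᵘ-fromℚᵘ (mkℚᵘ a 0)

ι-+ : ∀ a b → ι (a + b) ≡ ι a ℚ.+ ι b
ι-+ a b = ℚP.toℚᵘ-injective (begin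
  ℚ.toℚᵘ (ι (a + b))                     ≈⟨ ι-unnormalised (a + b) ⟩
  mkℚᵘ (a + b) 0                         ≈⟨ *≡* (unit-denominators a b) ⟩
  mkℚᵘ a 0 ℚᵘ.+ mkℚᵘ b 0                 ≈⟨ ℚᵘP.+-cong (ℚᵘP.≃-sym (ι-unnormalised a)) (ℚᵘP.≃-sym (ι-unnormalised b)) ⟩
  ℚ.toℚᵘ (ι a) ℚᵘ.+ ℚ.toℚᵘ (ι b)         ≈⟨ ℚᵘP.≃-sym (ℚP.toℚᵘ-homo-+ (ι a) (ι b)) ⟩
  ℚ.toℚᵘ (ι a ℚ.+ ι b)                   ∎)
  where
  open ℚᵘP.≃-Reasoning
  unit-denominators : ∀ (a b : ℤ) → (a + b) * + 1 ≡ (a * + 1 + b * + 1) * + 1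
  unit-denominators = solve-∀

ι-positive : ∀ a → + 0 < a ⇔ 0ℚ ℚ.< ι a
ι-positive a = mk⇔
  (λ pos → ℚP.toℚᵘ-cancel-< (ℚᵘP.<-respʳ-≃ (ℚᵘP.≃-sym (ι-unnormalised a))
             (*<* (subst (+ 0 <_) (sym (ℤP.*-identityʳ a)) pos))))
  (λ pos → case ℚᵘP.<-respʳ-≃ (ι-unnormalised a) (ℚP.toℚᵘ-mono-< pos) of λ where
             (*<* pos′) → subst (+ 0 <_) (ℤP.*-identityʳ a) pos′)

-- Uniform weights 1/m on a list of m ≥ 1 choice functions realise its strict majority
-- outcome in maj^cl: the weighted margin is the plain margin scaled by 1/m.
module UniformWeights (k : ℕ) where

  q : ℚ
  q = + 1 / suc k

  instance
    q-positive : ℚ.Positive q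
    q-positive = ℚP.normalize-pos 1 (suc k)

  q≥0 : 0ℚ ℚ.≤ q
  q≥0 = ℚP.<⇒≤ (ℚP.positive⁻¹ q)

  q≤1 : q ℚ.≤ 1ℚ
  q≤1 = ℚP.toℚᵘ-cancel-≤ (ℚᵘP.≤-respˡ-≃ (ℚᵘP.≃-sym (ℚP.toℚᵘ-fromℚᵘ (mkℚᵘ (+ 1) k)))
          (*≤* (ℤ.+≤+ (ℕ.s≤s ℕ.z≤n))))

  total : ι (+ suc k) ℚ.* q ≡ 1ℚ
  total = ℚP.toℚᵘ-injective (begin
    ℚ.toℚᵘ (ι (+ suc k) ℚ.* q)              ≈⟨ ℚP.toℚᵘ-homo-* (ι (+ suc k)) q ⟩
    ℚ.toℚᵘ (ι (+ suc k)) ℚᵘ.* ℚ.toℚᵘ q      ≈⟨ ℚᵘP.*-cong (ι-unnormalised (+ suc k)) (ℚP.toℚᵘ-fromℚᵘ (mkℚᵘ (+ 1) k)) ⟩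
    mkℚᵘ (+ suc k) 0 ℚᵘ.* mkℚᵘ (+ 1) k      ≈⟨ *≡* cross-multiplied ⟩
    ℚ.toℚᵘ 1ℚ                               ∎)
    where
    open ℚᵘP.≃-Reasoning
    cross-multiplied : (+ suc k * + 1) * + 1 ≡ + 1 * + (suc k ℕ.+ 0)
    cross-multiplied = trans (ℤP.*-identityʳ _) (trans (ℤP.*-identityʳ _)
      (trans (cong +_ (sym (ℕP.+-identityʳ (suc k)))) (sym (ℤP.*-identityˡ _))))

  scaled-positive : ∀ a → + 0 < a ⇔ 0ℚ ℚ.< ι a ℚ.* q
  scaled-positive a = mk⇔
    (λ pos → subst (ℚ._< ι a ℚ.* q) (ℚP.*-zeroˡ q) (ℚP.*-monoˡ-<-pos q (Equivalence.to (ι-positive a) pos)))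
    (λ pos → Equivalence.from (ι-positive a)
               (ℚP.*-cancelʳ-<-nonNeg q {{ℚP.pos⇒nonNeg q}} (subst (ℚ._< ι a ℚ.* q) (sym (ℚP.*-zeroˡ q)) pos)))

  uniform : ∀ {n} → List (Choice n) → List (Choice n × ℚ)
  uniform = map (λ c → c , q)

  weights-uniform : ∀ {n} (cs : List (Choice n)) → sumℚ (weights (uniform cs)) ≡ ι (+ length cs) ℚ.* q
  weights-uniform []       = sym (ℚP.*-zeroˡ q)
  weights-uniform (c ∷ cs) = begin
    q ℚ.+ sumℚ (weights (uniform cs))        ≡⟨ cong (q ℚ.+_) (weights-uniform cs) ⟩
    q ℚ.+ ι (+ length cs) ℚ.* q              ≡⟨ cong (ℚ._+ ι (+ length cs) ℚ.* q) (sym (ℚP.*-identityˡ q)) ⟩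
    1ℚ ℚ.* q ℚ.+ ι (+ length cs) ℚ.* q       ≡⟨ sym (ℚP.*-distribʳ-+ q 1ℚ (ι (+ length cs))) ⟩
    (1ℚ ℚ.+ ι (+ length cs)) ℚ.* q           ≡⟨ cong (ℚ._* q) (sym (ι-+ (+ 1) (+ length cs))) ⟩
    ι (+ suc (length cs)) ℚ.* q              ∎
    where open ≡-Reasoning

  weightedW-uniform : ∀ {n} (cs : List (Choice n)) u v → weightedW (uniform cs) u v ≡ ι (sumW cs u v) ℚ.* q
  weightedW-uniform []       u v = sym (ℚP.*-zeroˡ q)
  weightedW-uniform (c ∷ cs) u v = begin
    ι (W c u v) ℚ.* q ℚ.+ weightedW (uniform cs) u v   ≡⟨ cong (ι (W c u v) ℚ.* q ℚ.+_) (weightedW-uniform cs u v) ⟩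
    ι (W c u v) ℚ.* q ℚ.+ ι (sumW cs u v) ℚ.* q        ≡⟨ sym (ℚP.*-distribʳ-+ q (ι (W c u v)) (ι (sumW cs u v))) ⟩
    (ι (W c u v) ℚ.+ ι (sumW cs u v)) ℚ.* q            ≡⟨ cong (ℚ._* q) (sym (ι-+ (W c u v) (sumW cs u v))) ⟩
    ι (W c u v + sumW cs u v) ℚ.* q                    ∎
    where open ≡-Reasoning

majority⇒majCl : ∀ {n} {𝒞 : Family n} {d : Choice n} (cs : List (Choice n)) → ¬ cs ≡ [] →
                 All 𝒞 cs → IsStrictMajorityOutcome cs d → MajCl 𝒞 d
majority⇒majCl []       nonempty _    _       = ⊥-elim (nonempty refl)
majority⇒majCl (c ∷ cs) _        in-𝒞 outcome =
  uniform (c ∷ cs) ,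
  AllP.map⁺ (All.map (λ c∈𝒞 → c∈𝒞 , q≥0 , q≤1) in-𝒞) ,
  trans (weights-uniform (c ∷ cs)) total ,
  λ u v → subst (λ r → _ ⇔ (0ℚ ℚ.< r)) (sym (weightedW-uniform (c ∷ cs) u v))
                (scaled-positive (sumW (c ∷ cs) u v) ⇔-∘ outcome u v)
  where open UniformWeights (length cs)

mainTheorem5 : (n : ℕ) → 3 ℕ.≤ n → (𝒞 : Family n)
    → Symmetric 𝒞 → BalancedFamily 𝒞 → NonTrivial 𝒞
    → (x y z : Fin n) (x≢y : ¬ x ≡ y) (y≢z : ¬ y ≡ z) (z≢x : ¬ z ≡ x)
    → MajCl 𝒞 (triangular x y z x≢y y≢z z≢x)
      × Σ (List (Choice n)) (λ cs →
          All 𝒞 cs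
          × IsStrictMajorityOutcome cs (triangular x y z x≢y y≢z z≢x)
          × wins cs x y ≡ wins cs y z
          × wins cs y z ≡ wins cs z x
          × All (λ c → ¬ pick c x y ≡ just y × ¬ pick c y z ≡ just z × ¬ pick c z x ≡ just x) cs)
-- |X| ≥ 3 is implied by the three distinct alternatives and not used.
mainTheorem5 n _ 𝒞 symmetric balanced nontrivial x y z x≢y y≢z z≢x =
  majority⇒majCl {𝒞 = 𝒞} {d = triangular x y z x≢y y≢z z≢x} voters nonempty in-𝒞 outcome ,
  voters , in-𝒞 , outcome , wins-xy-yz , wins-yz-zx , All.map proj₂ admissible
  where
  open Triangle.Construction.Witness (Triangle.Construction.witness x≢y y≢z z≢x 𝒞 symmetric balanced nontrivial)
  in-𝒞 : All 𝒞 voters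
  in-𝒞 = All.map proj₁ admissible
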